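{- For $T=(T_1,\dots,T_\ell)\in[n]^\ell$ let $\chi_T(x)=\prod_{i=1}^\ell e^{2\pi i T_ix_i/n}$ and $|T|=|\{i:T_i\ne0\}|$. Then $\chi_T$ is an eigenvector of the random-walk matrix of $C_{n,\ell,\alpha}$ with eigenvalue $$\lambda_C(\chi_T)=\begin{cases}\dfrac{\binom{\ell-|T|}{(1-\alpha)\ell-|T|}}{\binom{\ell}{(1-\alpha)\ell}}, & |T|\le(1-\alpha)\ell,\\[2mm] 0,&\text{otherwise.}\end{cases}$$
   Context: $[n]=\mathbb{Z}/n\mathbb{Z}$; $\alpha\in(0,1)$, $\ell$ a positive integer with $\alpha\ell\in\mathbb{N}$, $n>\ell$. The Johnson-approximating graph $C_{n,\ell,\alpha}$ has vertex set $[n]^\ell$; a random neighbor of $X=(x_1,\dots,x_\ell)$ is $Z=(x_1+b_1y_1,\dots,x_\ell+b_\ell y_\ell)$ (mod $n$), with $y$ uniform in $[n]^\ell$ and $b$ uniform among vectors in $\{0,1\}^\ell$ of Hamming weight $\alpha\ell$. Its random-walk (normalized adjacency) matrix acts by $(Cf)(X)=\mathbb{E}_{y,b}[f(Z)]$. -}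

module Defs where

open import Level using (Level; _⊔_)
open import Data.Bool using (Bool; true; false; if_then_else_)
open import Data.Nat as ℕ using (ℕ; zero; suc; _≡ᵇ_; _≤ᵇ_; _∸_)
open import Data.Nat.DivMod using (_mod_)
open import Data.Nat.Combinatorics using (_C_)
open import Data.Fin using (Fin; toℕ)
open import Data.List using (List; []; _∷_; map; concatMap; allFin; length; filterᵇ; foldr)
open import Algebra.Bundles using (CommutativeRing)
open import Relation.Nullary using (¬_)

-- A field, presented as a commutative ring with a total inverse
-- operation that is a two-sided inverse on nonzero elements
-- (the value of 0⁻¹ is irrelevant).
record Field (c ℓ : Level) : Set (Level.suc (c ⊔ ℓ)) where
  field
    commRing : CommutativeRing c ℓ
  open CommutativeRing commRing public
  field
    _⁻¹     : Carrier → Carrier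
    1≉0     : ¬ (1# ≈ 0#)
    ⁻¹-inverse : ∀ x → ¬ (x ≈ 0#) → x * (x ⁻¹) ≈ 1#

module _ {c ℓ : Level} (F : Field c ℓ) where
  open Field F

  natCast : ℕ → Carrier
  natCast zero    = 0#
  natCast (suc m) = 1# + natCast m

  pow : Carrier → ℕ → Carrier
  pow x zero    = 1#
  pow x (suc m) = x * pow x m

  CharZero : Set ℓ
  CharZero = ∀ m → ¬ (natCast (suc m) ≈ 0#)

  PrimitiveRoot : ℕ → Carrier → Set ℓ
  PrimitiveRoot n ω = (pow ω n ≈ 1#) × (∀ j → 0 ℕ.< j → j ℕ.< n → ¬ (pow ω j ≈ 1#))
    where open import Data.Product using (_×_)

  sumF : List Carrier → Carrier
  sumF = foldr _+_ 0#

  average : {A : Set} → List A → (A → Carrier) → Carrier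
  average xs f = sumF (map f xs) * (natCast (length xs) ⁻¹)

allFuns : {A : Set} → List A → (m : ℕ) → List (Fin m → A)
allFuns as zero    = (λ ()) ∷ []
allFuns as (suc m) =
  concatMap (λ a → map (λ g → λ { Fin.zero → a ; (Fin.suc i) → g i }) (allFuns as m)) as

Vert : ℕ → ℕ → Set
Vert n ℓ = Fin ℓ → Fin n

allVert : (n ℓ : ℕ) → List (Vert n ℓ)
allVert n ℓ = allFuns (allFin n) ℓ

weight : {ℓ : ℕ} → (Fin ℓ → Bool) → ℕ
weight {ℓ} b = foldr ℕ._+_ 0 (map (λ i → if b i then 1 else 0) (allFin ℓ))

weightVecs : (ℓ w : ℕ) → List (Fin ℓ → Bool)
weightVecs ℓ w = filterᵇ (λ b → weight b ≡ᵇ w) (allFuns (false ∷ true ∷ []) ℓ)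

addMod : {n : ℕ} → Fin n → Fin n → Fin n
addMod {suc m} a b = (toℕ a ℕ.+ toℕ b) mod suc m

bitMul : {n : ℕ} → Bool → Fin n → Fin n
bitMul {zero}  _     ()
bitMul {suc m} true  y = y
bitMul {suc m} false y = Fin.zero

step : {n ℓ : ℕ} → Vert n ℓ → (Fin ℓ → Bool) → Vert n ℓ → Vert n ℓ
step x b y i = addMod (x i) (bitMul (b i) (y i))

supp : {n ℓ : ℕ} → Vert n ℓ → ℕ
supp {n} {ℓ} T = foldr ℕ._+_ 0 (map (λ i → if toℕ (T i) ≡ᵇ 0 then 0 else 1) (allFin ℓ))

module _ {c ℓ' : Level} (F : Field c ℓ') where
  open Field F

  -- random-walk matrix of C_{n,ℓ,α} with αℓ = k, acting on f : [n]^ℓ → F: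
  -- (C f)(X) = E_{y,b} f(X + b∘y)
  walk : (n ℓ k : ℕ) → (Vert n ℓ → Carrier) → Vert n ℓ → Carrier
  walk n ℓ k f x =
    average F (weightVecs ℓ k) (λ b → average F (allVert n ℓ) (λ y → f (step x b y)))

  -- χ_T(x) = ω^(Σ T_i x_i)  (ω plays the role of e^{2πi/n})
  character : {n ℓ : ℕ} → Carrier → Vert n ℓ → Vert n ℓ → Carrier
  character {n} {ℓ} ω T x =
    pow F ω (foldr ℕ._+_ 0 (map (λ i → toℕ (T i) ℕ.* toℕ (x i)) (allFin ℓ)))

  -- the claimed eigenvalue, with (1-α)ℓ = ℓ ∸ k
  eigenvalue : (ℓ k t : ℕ) → Carrier
  eigenvalue ℓ k t =
    if t ≤ᵇ (ℓ ∸ k)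
    then natCast F ((ℓ ∸ t) C ((ℓ ∸ k) ∸ t)) * (natCast F (ℓ C (ℓ ∸ k)) ⁻¹)
    else 0#

-- Write χ_T(x) = ∏ᵢ ω^(Tᵢ xᵢ). For a fixed bit vector b, the coordinates of the uniform
-- y ∈ [n]^ℓ are independent, so E_y χ_T(x + b∘y) factors over i. A coordinate with bᵢ = 0
-- is untouched; one with bᵢ = 1 is resampled uniformly, which multiplies its factor by
-- E_v ω^(Tᵢ v), equal to 1 if Tᵢ = 0 and to 0 otherwise (a geometric sum of the nontrivial
-- n-th root of unity ω^Tᵢ). Hence E_y χ_T(x + b∘y) is χ_T(x) when b and T have disjoint
-- supports and 0 otherwise, and averaging over the C(ℓ,k) vectors b of weight k = αℓ gives
-- C(ℓ − |T|, k) / C(ℓ, k), by Pascal's rule in ℓ. Complementing both binomial coefficients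
-- gives the stated form.

module Submission where

open import Level using (Level)
open import Algebra.Bundles using (CommutativeSemiring)
open import Data.Bool using (Bool; true; false; if_then_else_)
open import Data.Fin using (Fin; toℕ; inject₁; fromℕ)
open import Data.Fin.Properties using (toℕ-inject₁; toℕ-fromℕ; toℕ-fromℕ<; toℕ<n)
open import Data.List using (List; []; _∷_; _++_; map; concatMap; foldr; filterᵇ; allFin; tabulate; length)
open import Data.List.Properties using (map-++; map-∘; length-++; length-map; map-tabulate; length-tabulate)
open import Data.Nat as ℕ using (ℕ; _<_; _≤_; _∸_; _≡ᵇ_)
import Data.Nat.Properties as NP
open import Data.Nat.Combinatorics using (_C_; nCk≡nC[n∸k]; k>n⇒nCk≡0; nCk+nC[k+1]≡[n+1]C[k+1])
open import Data.Nat.DivMod using (_%_; _/_; m%n<n; m≡m%n+[m/n]*n; m<n⇒m%n≡m)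
open import Data.Nat.ListAction using (sum)
open import Algebra.Properties.CommutativeSemigroup NP.+-commutativeSemigroup
  using () renaming (interchange to +-interchange)
open import Data.Product using (proj₁; proj₂)
import Data.Vec.Functional as Vector
open import Function using (_∘_; id)
open import Relation.Nullary using (¬_; ofʸ; ofⁿ)
import Relation.Binary.PropositionalEquality as ≡
open ≡ using (_≡_)

open import Defs

foldr-tabulate : ∀ {a b} {A : Set a} {B : Set b} (f : A → B → B) (e : B) {m} (g : Fin m → A) →
                 foldr f e (tabulate g) ≡ Vector.foldr f e g
foldr-tabulate f e {ℕ.zero}  g = ≡.refl
foldr-tabulate f e {ℕ.suc m} g = ≡.cong (f (g Fin.zero)) (foldr-tabulate f e (g ∘ Fin.suc))

foldr-map-allFin : ∀ {b} {B : Set b} (f : B → B → B) (e : B) {m} (h : Fin m → B) →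
                   foldr f e (map h (allFin m)) ≡ Vector.foldr f e h
foldr-map-allFin f e {m} h = ≡.trans (≡.cong (foldr f e) (map-tabulate id h)) (foldr-tabulate f e h)

length-concatMap-map : ∀ {A B C : Set} (k : A → B → C) (xs : List A) (ys : List B) →
                       length (concatMap (λ x → map (k x) ys) xs) ≡ length xs ℕ.* length ys
length-concatMap-map k []       ys = ≡.refl
length-concatMap-map k (x ∷ xs) ys = begin
  length (map (k x) ys ++ concatMap (λ x → map (k x) ys) xs)    ≡⟨ length-++ (map (k x) ys) ⟩
  length (map (k x) ys) ℕ.+ length (concatMap (λ x → map (k x) ys) xs)
    ≡⟨ ≡.cong₂ ℕ._+_ (length-map (k x) ys) (length-concatMap-map k xs ys) ⟩
  length ys ℕ.+ length xs ℕ.* length ys                        ∎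
  where open ≡.≡-Reasoning

length-allFuns : ∀ {A : Set} (as : List A) m → length (allFuns as m) ≡ length as ℕ.^ m
length-allFuns as ℕ.zero    = ≡.refl
length-allFuns as (ℕ.suc m) =
  ≡.trans (length-concatMap-map _ as (allFuns as m)) (≡.cong (length as ℕ.*_) (length-allFuns as m))

module ListSum {c ℓ} (R : CommutativeSemiring c ℓ) where
  open CommutativeSemiring R
  open import Relation.Binary.Reasoning.Setoid setoid
  open import Algebra.Properties.CommutativeMonoid.Sum *-commutativeMonoid
    using () renaming (sum to ∏)

  ∑ᴸ : List Carrier → Carrier
  ∑ᴸ = foldr _+_ 0#

  ∑ᴸ-map-cong : ∀ {A : Set} {f g : A → Carrier} → (∀ x → f x ≈ g x) →
                ∀ xs → ∑ᴸ (map f xs) ≈ ∑ᴸ (map g xs)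
  ∑ᴸ-map-cong f≈g []       = refl
  ∑ᴸ-map-cong f≈g (x ∷ xs) = +-cong (f≈g x) (∑ᴸ-map-cong f≈g xs)

  ∑ᴸ-map-zero : ∀ {A : Set} (xs : List A) → ∑ᴸ (map (λ _ → 0#) xs) ≈ 0#
  ∑ᴸ-map-zero []       = refl
  ∑ᴸ-map-zero (x ∷ xs) = trans (+-identityˡ _) (∑ᴸ-map-zero xs)

  ∑ᴸ-++ : ∀ xs ys → ∑ᴸ (xs ++ ys) ≈ ∑ᴸ xs + ∑ᴸ ys
  ∑ᴸ-++ []       ys = sym (+-identityˡ _)
  ∑ᴸ-++ (x ∷ xs) ys = trans (+-congˡ (∑ᴸ-++ xs ys)) (sym (+-assoc _ _ _))

  *-distribˡ-∑ᴸ : ∀ {A : Set} a (f : A → Carrier) xs →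
                  a * ∑ᴸ (map f xs) ≈ ∑ᴸ (map (λ x → a * f x) xs)
  *-distribˡ-∑ᴸ a f []       = zeroʳ a
  *-distribˡ-∑ᴸ a f (x ∷ xs) = trans (distribˡ a _ _) (+-congˡ (*-distribˡ-∑ᴸ a f xs))

  *-distribʳ-∑ᴸ : ∀ {A : Set} a (f : A → Carrier) xs →
                  ∑ᴸ (map f xs) * a ≈ ∑ᴸ (map (λ x → f x * a) xs)
  *-distribʳ-∑ᴸ a f []       = zeroˡ a
  *-distribʳ-∑ᴸ a f (x ∷ xs) = trans (distribʳ a _ _) (+-congˡ (*-distribʳ-∑ᴸ a f xs))

  ∑ᴸ-filterᵇ : ∀ {A : Set} (p : A → Bool) (f : A → Carrier) xs →
               ∑ᴸ (map f (filterᵇ p xs)) ≈ ∑ᴸ (map (λ x → if p x then f x else 0#) xs)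
  ∑ᴸ-filterᵇ p f []       = refl
  ∑ᴸ-filterᵇ p f (x ∷ xs) with p x
  ... | true  = +-congˡ (∑ᴸ-filterᵇ p f xs)
  ... | false = trans (∑ᴸ-filterᵇ p f xs) (sym (+-identityˡ _))

  ∑ᴸ-concatMap-map : ∀ {A B C : Set} (φ : C → Carrier) (k : A → B → C) xs ys →
    ∑ᴸ (map φ (concatMap (λ x → map (k x) ys) xs)) ≈ ∑ᴸ (map (λ x → ∑ᴸ (map (φ ∘ k x) ys)) xs)
  ∑ᴸ-concatMap-map φ k []       ys = refl
  ∑ᴸ-concatMap-map φ k (x ∷ xs) ys = begin
    ∑ᴸ (map φ (map (k x) ys ++ rest))             ≡⟨ ≡.cong ∑ᴸ (map-++ φ (map (k x) ys) rest) ⟩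
    ∑ᴸ (map φ (map (k x) ys) ++ map φ rest)       ≈⟨ ∑ᴸ-++ (map φ (map (k x) ys)) (map φ rest) ⟩
    ∑ᴸ (map φ (map (k x) ys)) + ∑ᴸ (map φ rest)
      ≡⟨ ≡.cong (λ zs → ∑ᴸ zs + ∑ᴸ (map φ rest)) (≡.sym (map-∘ ys)) ⟩
    ∑ᴸ (map (φ ∘ k x) ys) + ∑ᴸ (map φ rest)       ≈⟨ +-congˡ (∑ᴸ-concatMap-map φ k xs ys) ⟩
    ∑ᴸ (map (φ ∘ k x) ys) + ∑ᴸ (map (λ x → ∑ᴸ (map (φ ∘ k x) ys)) xs) ∎
    where rest = concatMap (λ x → map (k x) ys) xs

  ∑ᴸ-allFuns-∏ : ∀ {A : Set} (as : List A) m (f : Fin m → A → Carrier) →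
    ∑ᴸ (map (λ y → ∏ (λ i → f i (y i))) (allFuns as m)) ≈ ∏ (λ i → ∑ᴸ (map (f i) as))
  ∑ᴸ-allFuns-∏ as ℕ.zero    f = +-identityʳ 1#
  ∑ᴸ-allFuns-∏ as (ℕ.suc m) f = begin
    ∑ᴸ (map (λ y → ∏ (λ i → f i (y i))) (allFuns as (ℕ.suc m)))
      ≈⟨ ∑ᴸ-concatMap-map (λ y → ∏ (λ i → f i (y i))) _ as (allFuns as m) ⟩
    ∑ᴸ (map (λ a → ∑ᴸ (map (λ y → f Fin.zero a * rest y) (allFuns as m))) as)
      ≈⟨ ∑ᴸ-map-cong (λ a → sym (*-distribˡ-∑ᴸ (f Fin.zero a) rest (allFuns as m))) as ⟩
    ∑ᴸ (map (λ a → f Fin.zero a * ∑ᴸ (map rest (allFuns as m))) as)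
      ≈⟨ *-distribʳ-∑ᴸ _ (f Fin.zero) as ⟨
    ∑ᴸ (map (f Fin.zero) as) * ∑ᴸ (map rest (allFuns as m))
      ≈⟨ *-congˡ (∑ᴸ-allFuns-∏ as m (f ∘ Fin.suc)) ⟩
    ∑ᴸ (map (f Fin.zero) as) * ∏ (λ i → ∑ᴸ (map (f (Fin.suc i)) as)) ∎
    where
    rest : (Fin m → _) → Carrier
    rest y = ∏ (λ i → f (Fin.suc i) (y i))

module ℕΣ = ListSum NP.+-*-commutativeSemiring

bits : List Bool
bits = false ∷ true ∷ []

bit : Bool → ℕ
bit b = if b then 1 else 0

-- Folds over Fin, unlike the folds over the list allFin in Defs, compute on the vectors
-- built by allFuns.
weightᵛ : ∀ {ℓ} → (Fin ℓ → Bool) → ℕ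
weightᵛ b = Vector.foldr ℕ._+_ 0 (bit ∘ b)

isZero : ℕ → ℕ
isZero ℕ.zero    = 1
isZero (ℕ.suc _) = 0

disjointAt : Bool → ℕ → ℕ
disjointAt false _ = 1
disjointAt true  t = isZero t

disjoint : ∀ {n ℓ} → Vert n ℓ → (Fin ℓ → Bool) → ℕ
disjoint T b = Vector.foldr ℕ._*_ 1 (λ i → disjointAt (b i) (toℕ (T i)))

zeros : ∀ {n ℓ} → Vert n ℓ → ℕ
zeros T = Vector.foldr ℕ._+_ 0 (λ i → isZero (toℕ (T i)))

-- The weight condition is a predicate P so that dropping a coordinate with bit 1
-- turns it into P ∘ suc.
countDisjoint : ∀ {n ℓ} → (ℕ → Bool) → Vert n ℓ → ℕ
countDisjoint {ℓ = ℓ} P T = sum (map (λ b → if P (weightᵛ b) then disjoint T b else 0) (allFuns bits ℓ))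

if-*ˡ : ∀ (p : Bool) c x → (if p then c ℕ.* x else 0) ≡ c ℕ.* (if p then x else 0)
if-*ˡ true  c x = ≡.refl
if-*ˡ false c x = ≡.sym (NP.*-zeroʳ c)

countDisjoint-suc : ∀ {n ℓ} P (T : Vert n (ℕ.suc ℓ)) →
  countDisjoint P T ≡
  countDisjoint P (Vector.tail T) ℕ.+ isZero (toℕ (T Fin.zero)) ℕ.* countDisjoint (P ∘ ℕ.suc) (Vector.tail T)
countDisjoint-suc {ℓ = ℓ} P T = begin
  countDisjoint P T
    ≡⟨ splitHead bits ⟩
  sum (map (λ b → if P (weightᵛ b) then 1 ℕ.* disjoint T′ b else 0) Bs) ℕ.+
  (sum (map (λ b → if P (ℕ.suc (weightᵛ b)) then z ℕ.* disjoint T′ b else 0) Bs) ℕ.+ 0)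
    ≡⟨ ≡.cong₂ ℕ._+_
         (ℕΣ.∑ᴸ-map-cong (λ b → ≡.cong (λ d → if P (weightᵛ b) then d else 0) (NP.*-identityˡ _)) Bs)
         (NP.+-identityʳ _) ⟩
  countDisjoint P T′ ℕ.+ sum (map (λ b → if P (ℕ.suc (weightᵛ b)) then z ℕ.* disjoint T′ b else 0) Bs)
    ≡⟨ ≡.cong (countDisjoint P T′ ℕ.+_) (ℕΣ.∑ᴸ-map-cong (λ b → if-*ˡ (P (ℕ.suc (weightᵛ b))) z _) Bs) ⟩
  countDisjoint P T′ ℕ.+ sum (map (λ b → z ℕ.* (if P (ℕ.suc (weightᵛ b)) then disjoint T′ b else 0)) Bs)
    ≡⟨ ≡.cong (countDisjoint P T′ ℕ.+_) (≡.sym (ℕΣ.*-distribˡ-∑ᴸ z _ Bs)) ⟩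
  countDisjoint P T′ ℕ.+ z ℕ.* countDisjoint (P ∘ ℕ.suc) T′ ∎
  where
  open ≡.≡-Reasoning
  T′ = Vector.tail T
  z  = isZero (toℕ (T Fin.zero))
  Bs = allFuns bits ℓ
  summand : (Fin (ℕ.suc ℓ) → Bool) → ℕ
  summand b = if P (weightᵛ b) then disjoint T b else 0
  -- For the concrete list bits Agda cannot read off the function allFuns conses with.
  splitHead : ∀ as → sum (map summand (allFuns as (ℕ.suc ℓ))) ≡
    sum (map (λ a → sum (map (λ b → if P (bit a ℕ.+ weightᵛ b)
                                    then disjointAt a (toℕ (T Fin.zero)) ℕ.* disjoint T′ b else 0)
                             (allFuns as ℓ))) as)
  splitHead as = ℕΣ.∑ᴸ-concatMap-map summand _ as (allFuns as ℓ)

countDisjoint-binomial : ∀ {n ℓ} k (T : Vert n ℓ) → countDisjoint (_≡ᵇ k) T ≡ zeros T C k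
countDisjoint-binomial {ℓ = ℕ.zero}  ℕ.zero    T = ≡.refl
countDisjoint-binomial {ℓ = ℕ.zero}  (ℕ.suc k) T = ≡.refl
countDisjoint-binomial {ℓ = ℕ.suc ℓ} k         T =
  ≡.trans (countDisjoint-suc (_≡ᵇ k) T) (pascal k (toℕ (T Fin.zero)))
  where
  T′ = Vector.tail T
  pascal : ∀ k t → countDisjoint (_≡ᵇ k) T′ ℕ.+ isZero t ℕ.* countDisjoint (λ w → ℕ.suc w ≡ᵇ k) T′
                   ≡ (isZero t ℕ.+ zeros T′) C k
  pascal k         (ℕ.suc t) = ≡.trans (NP.+-identityʳ _) (countDisjoint-binomial k T′)
  pascal ℕ.zero    ℕ.zero    =
    ≡.cong₂ ℕ._+_ (countDisjoint-binomial 0 T′) (≡.cong (1 ℕ.*_) (ℕΣ.∑ᴸ-map-zero (allFuns bits ℓ)))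
  pascal (ℕ.suc k) ℕ.zero    = begin
    countDisjoint (_≡ᵇ ℕ.suc k) T′ ℕ.+ 1 ℕ.* countDisjoint (_≡ᵇ k) T′
      ≡⟨ ≡.cong₂ ℕ._+_ (countDisjoint-binomial (ℕ.suc k) T′)
                      (≡.trans (NP.*-identityˡ _) (countDisjoint-binomial k T′)) ⟩
    zeros T′ C ℕ.suc k ℕ.+ zeros T′ C k ≡⟨ NP.+-comm (zeros T′ C ℕ.suc k) _ ⟩
    zeros T′ C k ℕ.+ zeros T′ C ℕ.suc k ≡⟨ nCk+nC[k+1]≡[n+1]C[k+1] (zeros T′) k ⟩
    ℕ.suc (zeros T′) C ℕ.suc k          ∎
    where open ≡.≡-Reasoning

supp+zeros≡ℓ : ∀ {n ℓ} (T : Vert n ℓ) → supp T ℕ.+ zeros T ≡ ℓ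
supp+zeros≡ℓ {ℓ = ℓ} T =
  ≡.trans (≡.cong (ℕ._+ zeros T) (foldr-map-allFin ℕ._+_ 0 (isNonZero ∘ toℕ ∘ T))) (nonZeros+zeros T)
  where
  isNonZero : ℕ → ℕ
  isNonZero t = if t ≡ᵇ 0 then 0 else 1
  isNonZero+isZero : ∀ t → isNonZero t ℕ.+ isZero t ≡ 1
  isNonZero+isZero ℕ.zero    = ≡.refl
  isNonZero+isZero (ℕ.suc t) = ≡.refl
  nonZeros+zeros : ∀ {ℓ} (T : Vert _ ℓ) → Vector.foldr ℕ._+_ 0 (isNonZero ∘ toℕ ∘ T) ℕ.+ zeros T ≡ ℓ
  nonZeros+zeros {ℕ.zero}  T = ≡.refl
  nonZeros+zeros {ℕ.suc ℓ} T = ≡.trans (+-interchange (isNonZero t) _ (isZero t) _)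
                              (≡.cong₂ ℕ._+_ (isNonZero+isZero t) (nonZeros+zeros (Vector.tail T)))
    where t = toℕ (T Fin.zero)

zeros≡ℓ∸supp : ∀ {n ℓ} (T : Vert n ℓ) → zeros T ≡ ℓ ∸ supp T
zeros≡ℓ∸supp T = ≡.sym (≡.trans (≡.cong (_∸ supp T) (≡.sym (supp+zeros≡ℓ T))) (NP.m+n∸m≡n (supp T) (zeros T)))

supp≤ℓ : ∀ {n ℓ} (T : Vert n ℓ) → supp T ≤ ℓ
supp≤ℓ T = ≡.subst (supp T ≤_) (supp+zeros≡ℓ T) (NP.m≤m+n (supp T) (zeros T))

∑-disjoint-weightVecs : ∀ {n ℓ} k (T : Vert n ℓ) → sum (map (disjoint T) (weightVecs ℓ k)) ≡ zeros T C k
∑-disjoint-weightVecs {ℓ = ℓ} k T = begin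
  sum (map (disjoint T) (weightVecs ℓ k))
    ≡⟨ ℕΣ.∑ᴸ-filterᵇ (λ b → weight b ≡ᵇ k) (disjoint T) (allFuns bits ℓ) ⟩
  sum (map (λ b → if weight b ≡ᵇ k then disjoint T b else 0) (allFuns bits ℓ))
    ≡⟨ ℕΣ.∑ᴸ-map-cong
         (λ b → ≡.cong (λ w → if w ≡ᵇ k then disjoint T b else 0) (foldr-map-allFin ℕ._+_ 0 (bit ∘ b)))
         (allFuns bits ℓ) ⟩
  countDisjoint (_≡ᵇ k) T
    ≡⟨ countDisjoint-binomial k T ⟩
  zeros T C k ∎
  where open ≡.≡-Reasoning

length≡sum-map-1 : ∀ {A : Set} (xs : List A) → length xs ≡ sum (map (λ _ → 1) xs)
length≡sum-map-1 []       = ≡.refl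
length≡sum-map-1 (x ∷ xs) = ≡.cong ℕ.suc (length≡sum-map-1 xs)

length-weightVecs : ∀ ℓ k → length (weightVecs ℓ k) ≡ ℓ C k
length-weightVecs ℓ k = begin
  length (weightVecs ℓ k)                      ≡⟨ length≡sum-map-1 (weightVecs ℓ k) ⟩
  sum (map (λ _ → 1) (weightVecs ℓ k))         ≡⟨ ℕΣ.∑ᴸ-map-cong (≡.sym ∘ disjoint-0ᵛ) (weightVecs ℓ k) ⟩
  sum (map (disjoint (0ᵛ {ℓ})) (weightVecs ℓ k)) ≡⟨ ∑-disjoint-weightVecs k (0ᵛ {ℓ}) ⟩
  zeros (0ᵛ {ℓ}) C k                           ≡⟨ ≡.cong (_C k) (zeros-0ᵛ ℓ) ⟩
  ℓ C k                                        ∎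
  where
  open ≡.≡-Reasoning
  0ᵛ : ∀ {ℓ} → Vert 1 ℓ
  0ᵛ _ = Fin.zero
  disjoint-0ᵛ : ∀ {ℓ} (b : Fin ℓ → Bool) → disjoint 0ᵛ b ≡ 1
  disjoint-0ᵛ {ℕ.zero}  b = ≡.refl
  disjoint-0ᵛ {ℕ.suc ℓ} b with b Fin.zero
  ... | false = ≡.cong (ℕ._+ 0) (disjoint-0ᵛ (Vector.tail b))
  ... | true  = ≡.cong (ℕ._+ 0) (disjoint-0ᵛ (Vector.tail b))
  zeros-0ᵛ : ∀ ℓ → zeros (0ᵛ {ℓ}) ≡ ℓ
  zeros-0ᵛ ℕ.zero    = ≡.refl
  zeros-0ᵛ (ℕ.suc ℓ) = ≡.cong ℕ.suc (zeros-0ᵛ ℓ)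

m≤o∸n⇒n≤o∸m : ∀ {m n o} → n ≤ o → m ≤ o ∸ n → n ≤ o ∸ m
m≤o∸n⇒n≤o∸m {m} {n} {o} n≤o m≤o∸n =
  NP.m+n≤o⇒m≤o∸n n (≡.subst (_≤ o) (NP.+-comm m n) (NP.m≤o∸n⇒m+n≤o m n≤o m≤o∸n))

binomial-complement : ∀ {ℓ k s} → k ≤ ℓ → s ≤ ℓ ∸ k → (ℓ ∸ s) C k ≡ (ℓ ∸ s) C ((ℓ ∸ k) ∸ s)
binomial-complement {ℓ} {k} {s} k≤ℓ s≤ℓ∸k = begin
  (ℓ ∸ s) C k               ≡⟨ nCk≡nC[n∸k] (m≤o∸n⇒n≤o∸m {s} {k} k≤ℓ s≤ℓ∸k) ⟩
  (ℓ ∸ s) C ((ℓ ∸ s) ∸ k)   ≡⟨ ≡.cong ((ℓ ∸ s) C_) ∸-comm ⟩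
  (ℓ ∸ s) C ((ℓ ∸ k) ∸ s)   ∎
  where
  open ≡.≡-Reasoning
  ∸-comm : (ℓ ∸ s) ∸ k ≡ (ℓ ∸ k) ∸ s
  ∸-comm = ≡.trans (NP.∸-+-assoc ℓ s k) (≡.trans (≡.cong (ℓ ∸_) (NP.+-comm s k)) (≡.sym (NP.∸-+-assoc ℓ k s)))

binomial-vanish : ∀ {ℓ k s} → s ≤ ℓ → ¬ (s ≤ ℓ ∸ k) → (ℓ ∸ s) C k ≡ 0
binomial-vanish {k = k} s≤ℓ s≰ℓ∸k =
  k>n⇒nCk≡0 (NP.≰⇒> (λ k≤ℓ∸s → s≰ℓ∸k (m≤o∸n⇒n≤o∸m {k} s≤ℓ k≤ℓ∸s)))

module FieldArithmetic {c ℓ′} (F : Field c ℓ′) where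
  open Field F
  open ListSum commutativeSemiring public
  open import Algebra.Properties.Semiring.Mult semiring using (_×_; ×-homo-+; ×1-homo-*)
  open import Algebra.Properties.Semiring.Exp semiring public using (_^_; ^-homo-*; ^-assocʳ; ^-congˡ)
  open import Algebra.Properties.CommutativeMonoid.Sum *-commutativeMonoid public
    using () renaming (sum to ∏; sum-cong-≋ to ∏-cong; ∑-distrib-+ to ∏-distrib-*; sum-replicate to ∏-const)
  open import Algebra.Properties.Ring ring using (+-cancelʳ; x∙y⁻¹≈ε⇒x≈y; x≈y⇒x∙y⁻¹≈ε; [y-z]x≈yx-zx)
  open import Algebra.Properties.Semiring.Sum semiring public
    using (sum-cong-≗; *-distribˡ-sum; sum-init-last) renaming (sum to ∑)
  open import Algebra.Properties.CommutativeSemigroup *-commutativeSemigroup using (xy∙z≈xz∙y)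
  open import Relation.Binary.Reasoning.Setoid setoid

  natCast≡× : ∀ m → natCast F m ≡ m × 1#
  natCast≡× ℕ.zero    = ≡.refl
  natCast≡× (ℕ.suc m) = ≡.cong (1# +_) (natCast≡× m)

  natCast-+ : ∀ m n → natCast F (m ℕ.+ n) ≈ natCast F m + natCast F n
  natCast-+ m n rewrite natCast≡× (m ℕ.+ n) | natCast≡× m | natCast≡× n = ×-homo-+ 1# m n

  natCast-* : ∀ m n → natCast F (m ℕ.* n) ≈ natCast F m * natCast F n
  natCast-* m n rewrite natCast≡× (m ℕ.* n) | natCast≡× m | natCast≡× n = ×1-homo-* m n

  natCast-^ : ∀ m e → natCast F (m ℕ.^ e) ≈ natCast F m ^ e
  natCast-^ m ℕ.zero    = +-identityʳ 1#
  natCast-^ m (ℕ.suc e) = trans (natCast-* m (m ℕ.^ e)) (*-congˡ (natCast-^ m e))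

  natCast-sum : ∀ {A : Set} (h : A → ℕ) xs → ∑ᴸ (map (natCast F ∘ h) xs) ≈ natCast F (sum (map h xs))
  natCast-sum h []       = refl
  natCast-sum h (x ∷ xs) = trans (+-congˡ (natCast-sum h xs)) (sym (natCast-+ (h x) _))

  natCast-product : ∀ {m} (h : Fin m → ℕ) → natCast F (Vector.foldr ℕ._*_ 1 h) ≈ ∏ (natCast F ∘ h)
  natCast-product {ℕ.zero}  h = +-identityʳ 1#
  natCast-product {ℕ.suc m} h = trans (natCast-* (h Fin.zero) _) (*-congˡ (natCast-product (Vector.tail h)))

  ∑ᴸ-const : ∀ {A : Set} a (xs : List A) → ∑ᴸ (map (λ _ → a) xs) ≈ natCast F (length xs) * a
  ∑ᴸ-const a []       = sym (zeroˡ a)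
  ∑ᴸ-const a (x ∷ xs) = begin
    a + ∑ᴸ (map (λ _ → a) xs)              ≈⟨ +-congˡ (∑ᴸ-const a xs) ⟩
    a + natCast F (length xs) * a          ≈⟨ +-congʳ (*-identityˡ a) ⟨
    1# * a + natCast F (length xs) * a     ≈⟨ distribʳ a 1# _ ⟨
    (1# + natCast F (length xs)) * a       ∎

  pow≡^ : ∀ x m → pow F x m ≡ x ^ m
  pow≡^ x ℕ.zero    = ≡.refl
  pow≡^ x (ℕ.suc m) = ≡.cong (x *_) (pow≡^ x m)

  ^-sum : ∀ x {m} (h : Fin m → ℕ) → x ^ Vector.foldr ℕ._+_ 0 h ≈ ∏ (λ i → x ^ h i)
  ^-sum x {ℕ.zero}  h = refl
  ^-sum x {ℕ.suc m} h = trans (^-homo-* x (h Fin.zero) _) (*-congˡ (^-sum x (Vector.tail h)))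

  1^n≈1 : ∀ n → 1# ^ n ≈ 1#
  1^n≈1 ℕ.zero    = refl
  1^n≈1 (ℕ.suc n) = trans (*-identityˡ _) (1^n≈1 n)

  ^-mod : ∀ {x} n .{{_ : ℕ.NonZero n}} → x ^ n ≈ 1# → ∀ m → x ^ m ≈ x ^ (m % n)
  ^-mod {x} n xⁿ≈1 m = begin
    x ^ m
      ≡⟨ ≡.cong (x ^_) (≡.trans (m≡m%n+[m/n]*n m n) (≡.cong (m % n ℕ.+_) (NP.*-comm (m / n) n))) ⟩
    x ^ (m % n ℕ.+ n ℕ.* (m / n))       ≈⟨ ^-homo-* x (m % n) _ ⟩
    x ^ (m % n) * x ^ (n ℕ.* (m / n))   ≈⟨ *-congˡ (^-assocʳ x n (m / n)) ⟨
    x ^ (m % n) * (x ^ n) ^ (m / n)     ≈⟨ *-congˡ (trans (^-congˡ (m / n) xⁿ≈1) (1^n≈1 (m / n))) ⟩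
    x ^ (m % n) * 1#                    ≈⟨ *-identityʳ _ ⟩
    x ^ (m % n)                         ∎

  x≉0⇒x*y≈0⇒y≈0 : ∀ {x y} → ¬ (x ≈ 0#) → x * y ≈ 0# → y ≈ 0#
  x≉0⇒x*y≈0⇒y≈0 {x} {y} x≉0 xy≈0 = begin
    y                  ≈⟨ *-identityˡ y ⟨
    1# * y             ≈⟨ *-congʳ (trans (*-comm _ _) (⁻¹-inverse x x≉0)) ⟨
    (x ⁻¹ * x) * y     ≈⟨ *-assoc _ _ _ ⟩
    x ⁻¹ * (x * y)     ≈⟨ *-congˡ xy≈0 ⟩
    x ⁻¹ * 0#          ≈⟨ zeroʳ _ ⟩
    0#                 ∎

  *-⁻¹-cancelˡ : ∀ {x} y → ¬ (x ≈ 0#) → (x * y) * x ⁻¹ ≈ y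
  *-⁻¹-cancelˡ {x} y x≉0 = begin
    (x * y) * x ⁻¹     ≈⟨ *-congʳ (*-comm x y) ⟩
    (y * x) * x ⁻¹     ≈⟨ *-assoc _ _ _ ⟩
    y * (x * x ⁻¹)     ≈⟨ *-congˡ (⁻¹-inverse x x≉0) ⟩
    y * 1#             ≈⟨ *-identityʳ y ⟩
    y                  ∎

  powers : Carrier → (n : ℕ) → Vector.Vector Carrier n
  powers z n j = z ^ toℕ j

  geometric-sum : ∀ z n → 1# + z * ∑ (powers z n) ≈ ∑ (powers z n) + z ^ n
  geometric-sum z n = begin
    1# + z * ∑ (powers z n)            ≈⟨ +-congˡ (*-distribˡ-sum z (powers z n)) ⟩
    ∑ (powers z (ℕ.suc n))             ≈⟨ sum-init-last (powers z (ℕ.suc n)) ⟩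
    ∑ (powers z (ℕ.suc n) ∘ inject₁) + z ^ toℕ (fromℕ n)
      ≡⟨ ≡.cong₂ (λ s e → s + z ^ e)
                 (sum-cong-≗ {n} {powers z (ℕ.suc n) ∘ inject₁} {powers z n} (≡.cong (z ^_) ∘ toℕ-inject₁))
                 (toℕ-fromℕ n) ⟩
    ∑ (powers z n) + z ^ n             ∎

  root-of-unity-sum : ∀ {z n} → ¬ (z ≈ 1#) → z ^ n ≈ 1# → ∑ (powers z n) ≈ 0#
  root-of-unity-sum {z} {n} z≉1 zⁿ≈1 = x≉0⇒x*y≈0⇒y≈0 (z≉1 ∘ x∙y⁻¹≈ε⇒x≈y z 1#) (begin
    (z - 1#) * G          ≈⟨ [y-z]x≈yx-zx G z 1# ⟩
    z * G - 1# * G        ≈⟨ x≈y⇒x∙y⁻¹≈ε (trans zG≈G (sym (*-identityˡ G))) ⟩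
    0#                    ∎)
    where
    G = ∑ (powers z n)
    zG≈G : z * G ≈ G
    zG≈G = +-cancelʳ 1# (z * G) G (begin
      z * G + 1#   ≈⟨ +-comm _ _ ⟩
      1# + z * G   ≈⟨ geometric-sum z n ⟩
      G + z ^ n    ≈⟨ +-congˡ zⁿ≈1 ⟩
      G + 1#       ∎)

  natCast[1]*x≈x : ∀ x → natCast F 1 * x ≈ x
  natCast[1]*x≈x x = trans (*-congʳ (+-identityʳ 1#)) (*-identityˡ x)

  natCast-nonZero : CharZero F → ∀ m .{{_ : ℕ.NonZero m}} → ¬ (natCast F m ≈ 0#)
  natCast-nonZero charZero (ℕ.suc m) = charZero m

  average-natCast-* : ∀ {A : Set} (xs : List A) (h : A → ℕ) c →
    average F xs (λ a → natCast F (h a) * c) ≈ (natCast F (sum (map h xs)) * natCast F (length xs) ⁻¹) * c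
  average-natCast-* xs h c = begin
    ∑ᴸ (map (λ a → natCast F (h a) * c) xs) * L⁻¹     ≈⟨ *-congʳ (*-distribʳ-∑ᴸ c (natCast F ∘ h) xs) ⟨
    (∑ᴸ (map (natCast F ∘ h) xs) * c) * L⁻¹           ≈⟨ *-congʳ (*-congʳ (natCast-sum h xs)) ⟩
    (natCast F (sum (map h xs)) * c) * L⁻¹            ≈⟨ xy∙z≈xz∙y _ c L⁻¹ ⟩
    (natCast F (sum (map h xs)) * L⁻¹) * c            ∎
    where L⁻¹ = natCast F (length xs) ⁻¹

  eigenvalue-binomial : ∀ {ℓ k s} → k ≤ ℓ → s ≤ ℓ →
    natCast F ((ℓ ∸ s) C k) * natCast F (ℓ C k) ⁻¹ ≈ eigenvalue F ℓ k s
  eigenvalue-binomial {ℓ} {k} {s} k≤ℓ s≤ℓ with s ℕ.≤ᵇ (ℓ ∸ k) | NP.≤ᵇ-reflects-≤ s (ℓ ∸ k)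
  ... | true  | ofʸ s≤ℓ∸k = reflexive (≡.cong₂ (λ a b → natCast F a * natCast F b ⁻¹)
                                               (binomial-complement k≤ℓ s≤ℓ∸k) (nCk≡nC[n∸k] k≤ℓ))
  ... | false | ofⁿ s≰ℓ∸k =
    trans (reflexive (≡.cong (λ a → natCast F a * _) (binomial-vanish {ℓ} {k} s≤ℓ s≰ℓ∸k))) (zeroˡ _)

module CharacterSums {c ℓ′} (F : Field c ℓ′) (charZero : CharZero F)
                     (ω : Field.Carrier F) (n : ℕ) (ω-primitive : PrimitiveRoot F (ℕ.suc n) ω) where
  open Field F
  open FieldArithmetic F
  open import Algebra.Properties.CommutativeSemigroup *-commutativeSemigroup using (x∙yz≈y∙xz)
  open import Relation.Binary.Reasoning.Setoid setoid

  N : ℕ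
  N = ℕ.suc n

  ωᴺ≈1 : ω ^ N ≈ 1#
  ωᴺ≈1 = trans (reflexive (≡.sym (pow≡^ ω N))) (proj₁ ω-primitive)

  ω^t≉1 : ∀ {t} → 0 < t → t < N → ¬ (ω ^ t ≈ 1#)
  ω^t≉1 {t} 0<t t<N ωᵗ≈1 = proj₂ ω-primitive t 0<t t<N (trans (reflexive (pow≡^ ω t)) ωᵗ≈1)

  [ω^t]ᴺ≈1 : ∀ t → (ω ^ t) ^ N ≈ 1#
  [ω^t]ᴺ≈1 t = begin
    (ω ^ t) ^ N      ≈⟨ ^-assocʳ ω t N ⟩
    ω ^ (t ℕ.* N)    ≡⟨ ≡.cong (ω ^_) (NP.*-comm t N) ⟩
    ω ^ (N ℕ.* t)    ≈⟨ ^-assocʳ ω N t ⟨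
    (ω ^ N) ^ t      ≈⟨ ^-congˡ t ωᴺ≈1 ⟩
    1# ^ t           ≈⟨ 1^n≈1 t ⟩
    1#               ∎

  character≈∏ : ∀ {ℓ} (T x : Vert N ℓ) → character F ω T x ≈ ∏ (λ i → ω ^ (toℕ (T i) ℕ.* toℕ (x i)))
  character≈∏ {ℓ} T x = begin
    pow F ω (foldr ℕ._+_ 0 (map e (allFin ℓ)))    ≡⟨ pow≡^ ω (foldr ℕ._+_ 0 (map e (allFin ℓ))) ⟩
    ω ^ foldr ℕ._+_ 0 (map e (allFin ℓ))          ≡⟨ ≡.cong (ω ^_) (foldr-map-allFin ℕ._+_ 0 e) ⟩
    ω ^ Vector.foldr ℕ._+_ 0 e                    ≈⟨ ^-sum ω e ⟩
    ∏ (λ i → ω ^ e i)                             ∎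
    where
    e : Fin ℓ → ℕ
    e i = toℕ (T i) ℕ.* toℕ (x i)

  toℕ-addMod : ∀ (u v : Fin N) → toℕ (addMod u v) ≡ (toℕ u ℕ.+ toℕ v) % N
  toℕ-addMod u v = toℕ-fromℕ< (m%n<n (toℕ u ℕ.+ toℕ v) N)

  ∑-constant : ∀ {f : Fin N → Carrier} {a} → (∀ v → f v ≈ a) → ∑ᴸ (map f (allFin N)) ≈ natCast F N * a
  ∑-constant {f} {a} f≈a = begin
    ∑ᴸ (map f (allFin N))               ≈⟨ ∑ᴸ-map-cong f≈a (allFin N) ⟩
    ∑ᴸ (map (λ _ → a) (allFin N))       ≈⟨ ∑ᴸ-const a (allFin N) ⟩
    natCast F (length (allFin N)) * a   ≡⟨ ≡.cong (λ m → natCast F m * a) (length-tabulate {n = N} id) ⟩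
    natCast F N * a                     ∎

  ∑-translate : ∀ t (u : Fin N) →
    ∑ᴸ (map (λ v → ω ^ (t ℕ.* toℕ (addMod u v))) (allFin N)) ≈ (ω ^ t) ^ toℕ u * ∑ (powers (ω ^ t) N)
  ∑-translate t u = begin
    ∑ᴸ (map (λ v → ω ^ (t ℕ.* toℕ (addMod u v))) (allFin N))   ≈⟨ ∑ᴸ-map-cong shift (allFin N) ⟩
    ∑ᴸ (map (λ v → z ^ toℕ u * z ^ toℕ v) (allFin N))          ≈⟨ *-distribˡ-∑ᴸ (z ^ toℕ u) (powers z N) (allFin N) ⟨
    z ^ toℕ u * ∑ᴸ (map (powers z N) (allFin N))               ≡⟨ ≡.cong (z ^ toℕ u *_) (foldr-map-allFin _+_ 0# (powers z N)) ⟩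
    z ^ toℕ u * ∑ (powers z N)                                 ∎
    where
    z = ω ^ t
    shift : ∀ v → ω ^ (t ℕ.* toℕ (addMod u v)) ≈ z ^ toℕ u * z ^ toℕ v
    shift v = begin
      ω ^ (t ℕ.* toℕ (addMod u v))          ≈⟨ ^-assocʳ ω t _ ⟨
      z ^ toℕ (addMod u v)                  ≡⟨ ≡.cong (z ^_) (toℕ-addMod u v) ⟩
      z ^ ((toℕ u ℕ.+ toℕ v) % N)           ≈⟨ ^-mod N ([ω^t]ᴺ≈1 t) (toℕ u ℕ.+ toℕ v) ⟨
      z ^ (toℕ u ℕ.+ toℕ v)                 ≈⟨ ^-homo-* z (toℕ u) (toℕ v) ⟩
      z ^ toℕ u * z ^ toℕ v                 ∎

  ∑-coordinate : ∀ b {t} → t < N → (u : Fin N) →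
    ∑ᴸ (map (λ v → ω ^ (t ℕ.* toℕ (addMod u (bitMul b v)))) (allFin N)) ≈
    natCast F (disjointAt b t) * (natCast F N * ω ^ (t ℕ.* toℕ u))
  ∑-coordinate false {t} _ u = trans (∑-constant (λ _ → reflexive (≡.cong (λ m → ω ^ (t ℕ.* m)) u+0≡u)))
                                     (sym (natCast[1]*x≈x _))
    where
    u+0≡u : toℕ (addMod u Fin.zero) ≡ toℕ u
    u+0≡u = ≡.trans (toℕ-addMod u Fin.zero) (≡.trans (≡.cong (_% N) (NP.+-identityʳ (toℕ u))) (m<n⇒m%n≡m (toℕ<n u)))
  ∑-coordinate true {ℕ.zero}  _   u = trans (∑-constant (λ _ → refl)) (sym (natCast[1]*x≈x _))
  ∑-coordinate true {ℕ.suc t} t<N u = begin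
    ∑ᴸ (map (λ v → ω ^ (ℕ.suc t ℕ.* toℕ (addMod u v))) (allFin N))  ≈⟨ ∑-translate (ℕ.suc t) u ⟩
    z ^ toℕ u * ∑ (powers z N)
      ≈⟨ *-congˡ (root-of-unity-sum {z} {N} (ω^t≉1 {ℕ.suc t} (ℕ.s≤s ℕ.z≤n) t<N) ([ω^t]ᴺ≈1 (ℕ.suc t))) ⟩
    z ^ toℕ u * 0#                        ≈⟨ zeroʳ _ ⟩
    0#                                    ≈⟨ zeroˡ _ ⟨
    0# * (natCast F N * ω ^ (ℕ.suc t ℕ.* toℕ u)) ∎
    where z = ω ^ ℕ.suc t

  ∑-step-character : ∀ {ℓ} (T x : Vert N ℓ) b →
    ∑ᴸ (map (λ y → character F ω T (step x b y)) (allVert N ℓ)) ≈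
    natCast F (disjoint T b) * (natCast F N ^ ℓ * character F ω T x)
  ∑-step-character {ℓ} T x b = begin
    ∑ᴸ (map (λ y → character F ω T (step x b y)) (allVert N ℓ))
      ≈⟨ ∑ᴸ-map-cong (λ y → character≈∏ T (step x b y)) (allVert N ℓ) ⟩
    ∑ᴸ (map (λ y → ∏ (λ i → f i (y i))) (allVert N ℓ))
      ≈⟨ ∑ᴸ-allFuns-∏ (allFin N) ℓ f ⟩
    ∏ (λ i → ∑ᴸ (map (f i) (allFin N)))
      ≈⟨ ∏-cong {ℓ} (λ i → ∑-coordinate (b i) (toℕ<n (T i)) (x i)) ⟩
    ∏ (λ i → d i * (natCast F N * χ i))
      ≈⟨ trans (∏-distrib-* {ℓ} d _) (*-congˡ (∏-distrib-* {ℓ} (λ _ → natCast F N) χ)) ⟩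
    ∏ d * (∏ {ℓ} (λ _ → natCast F N) * ∏ χ)
      ≈⟨ *-cong (sym (natCast-product (λ i → disjointAt (b i) (toℕ (T i)))))
                (*-cong (∏-const ℓ {natCast F N}) (sym (character≈∏ T x))) ⟩
    natCast F (disjoint T b) * (natCast F N ^ ℓ * character F ω T x) ∎
    where
    f : Fin ℓ → Fin N → Carrier
    f i v = ω ^ (toℕ (T i) ℕ.* toℕ (addMod (x i) (bitMul (b i) v)))
    d χ : Fin ℓ → Carrier
    d i = natCast F (disjointAt (b i) (toℕ (T i)))
    χ i = ω ^ (toℕ (T i) ℕ.* toℕ (x i))

  average-step-character : ∀ {ℓ} (T x : Vert N ℓ) b →
    average F (allVert N ℓ) (λ y → character F ω T (step x b y)) ≈ natCast F (disjoint T b) * character F ω T x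
  average-step-character {ℓ} T x b = begin
    ∑ᴸ (map (λ y → character F ω T (step x b y)) (allVert N ℓ)) * L ⁻¹
      ≈⟨ *-congʳ (∑-step-character T x b) ⟩
    (natCast F (disjoint T b) * (natCast F N ^ ℓ * character F ω T x)) * L ⁻¹
      ≈⟨ *-congʳ (x∙yz≈y∙xz _ _ _) ⟩
    (natCast F N ^ ℓ * (natCast F (disjoint T b) * character F ω T x)) * L ⁻¹
      ≈⟨ *-congʳ (*-congʳ L≈Nˡ) ⟨
    (L * (natCast F (disjoint T b) * character F ω T x)) * L ⁻¹
      ≈⟨ *-⁻¹-cancelˡ _ L≉0 ⟩
    natCast F (disjoint T b) * character F ω T x ∎
    where
    L = natCast F (length (allVert N ℓ))
    |V|≡Nˡ : length (allVert N ℓ) ≡ N ℕ.^ ℓ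
    |V|≡Nˡ = ≡.trans (length-allFuns (allFin N) ℓ) (≡.cong (ℕ._^ ℓ) (length-tabulate {n = N} id))
    L≉0 : ¬ (L ≈ 0#)
    L≉0 = natCast-nonZero charZero (N ℕ.^ ℓ) {{NP.m^n≢0 N ℓ}} ∘ trans (reflexive (≡.cong (natCast F) (≡.sym |V|≡Nˡ)))
    L≈Nˡ : L ≈ natCast F N ^ ℓ
    L≈Nˡ = trans (reflexive (≡.cong (natCast F) |V|≡Nˡ)) (natCast-^ N ℓ)

lemmaC4 : {c ℓ' : Level} (F : Field c ℓ') → CharZero F →
          (ω : Field.Carrier F) → (n ℓ k : ℕ) → PrimitiveRoot F n ω →
          0 < ℓ → ℓ < n → 0 < k → k < ℓ →
          (T : Vert n ℓ) → (x : Vert n ℓ) →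
          Field._≈_ F (walk F n ℓ k (character F ω T) x)
                      (Field._*_ F (eigenvalue F ℓ k (supp T)) (character F ω T x))
lemmaC4 F charZero ω ℕ.zero    ℓ k ω-primitive _ () _ _   T x
lemmaC4 F charZero ω (ℕ.suc n) ℓ k ω-primitive _ _  _ k<ℓ T x = begin
  walk F N ℓ k (character F ω T) x
    ≈⟨ *-congʳ (∑ᴸ-map-cong (average-step-character T x) W) ⟩
  average F W (λ b → natCast F (disjoint T b) * χx)
    ≈⟨ average-natCast-* W (disjoint T) χx ⟩
  (natCast F (sum (map (disjoint T) W)) * natCast F (length W) ⁻¹) * χx
    ≡⟨ ≡.cong₂ (λ a b → (natCast F a * natCast F b ⁻¹) * χx)
               (≡.trans (∑-disjoint-weightVecs k T) (≡.cong (_C k) (zeros≡ℓ∸supp T)))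
               (length-weightVecs ℓ k) ⟩
  (natCast F ((ℓ ∸ supp T) C k) * natCast F (ℓ C k) ⁻¹) * χx
    ≈⟨ *-congʳ (eigenvalue-binomial (NP.<⇒≤ k<ℓ) (supp≤ℓ T)) ⟩
  eigenvalue F ℓ k (supp T) * χx ∎
  where
  open Field F
  open FieldArithmetic F
  open CharacterSums F charZero ω n ω-primitive
  open import Relation.Binary.Reasoning.Setoid setoid
  W  = weightVecs ℓ k
  χx = character F ω T x
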